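{- For integers $1\le n\le m$, $\left\lceil\frac{n-1}{3}\right\rceil\le \mathrm{thin}(GR_{n,m})\le\left\lceil\frac{n+1}{2}\right\rceil$.
   Context: $GR_{n,m}$ is the grid graph with vertex set $\{(i,j):1\le i\le n,1\le j\le m\}$ where $(i,j)$ and $(k,l)$ are adjacent iff $|i-k|+|j-l|=1$. An ordering $<$ of $V(G)$ is consistent with a partition $\mathcal{V}$ if for every $p<q<r$ with $p,q$ in the same class and $pr\in E(G)$, also $qr\in E(G)$. The thinness $\mathrm{thin}(G)$ is the minimum $k$ such that there exist a partition of $V(G)$ into $k$ classes and an ordering consistent with it. -}

module Defs where

open import Data.Nat using (ℕ; zero; suc; _+_; _∸_; _≤_; _<_)
open import Data.Nat.DivMod using (_/_)
open import Data.Fin using (Fin; toℕ)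
open import Data.Product using (Σ; _×_; ∃)
open import Data.Sum using (_⊎_)
open import Relation.Binary.PropositionalEquality using (_≡_)
open import Function.Definitions using (Injective)

record Graph : Set₁ where
  field
    V   : Set
    Adj : V → V → Set

open Graph public

⌈_/suc_⌉ : ℕ → ℕ → ℕ
⌈ a /suc b ⌉ = (a + b) / suc b

Dist1 : ℕ → ℕ → Set
Dist1 x y = suc x ≡ y ⊎ suc y ≡ x

GR : ℕ → ℕ → Graph
GR n m = record
  { V   = Fin n × Fin m
  ; Adj = λ { (i Data.Product., j) (k Data.Product., l) →
              (toℕ i ≡ toℕ k × Dist1 (toℕ j) (toℕ l))
            ⊎ (Dist1 (toℕ i) (toℕ k) × toℕ j ≡ toℕ l) } }

-- An ordering < of V(G) is represented by an injective rank map V → ℕ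
-- (p < q iff rank p < rank q); a partition into k classes by a map V → Fin k.
Consistent : (G : Graph) {k : ℕ} → (V G → ℕ) → (V G → Fin k) → Set
Consistent G rank cls =
  ∀ p q r → rank p < rank q → rank q < rank r →
  cls p ≡ cls q → Adj G p r → Adj G q r

KThin : Graph → ℕ → Set
KThin G k = Σ (V G → ℕ) λ rank → Injective _≡_ _≡_ rank ×
            Σ (V G → Fin k) λ cls → Consistent G rank cls

IsThinness : Graph → ℕ → Set
IsThinness G t = KThin G t × (∀ k → KThin G k → t ≤ k)

{-# OPTIONS --safe #-}
module Submission where

-- Upper bound: rows 2t and 2t + 1 form class t, except that the cells lying in an odd row
-- and an odd column move up to class t + 1; the cells are ordered by sweeping the grid
-- column by column in alternating directions.  Consistency of a triple is invariant under
-- translation by two rows or two columns, so it is checked exhaustively on a small window.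
--
-- Lower bound: let s + 1 be the least t such that some line (row or column) is ranked
-- entirely below t, say a column.  Every row whose cell in that column is ranked below s
-- has two adjacent cells ranked on either side of s, and consistency forbids two such
-- rows of equal parity to have their lower cells in the same class.  Hence n ≤ 2k + 1.
--
-- Existence of the minimum: a witness of k-thinness of a finite graph can be normalised
-- to ranks below the number of vertices, so k-thinness is decidable.

open import Defs
open import Level using (0ℓ)
open import Data.Nat.Base
  using (ℕ; zero; suc; _+_; _*_; _∸_; _≤_; _<_; z≤n; s≤s; s≤s⁻¹; z<s; s<s; s<s⁻¹;
         ⌊_/2⌋; parity)
open import Data.Nat.Properties
open import Data.Nat.DivMod using (_/_; m/n≡1+[m∸n]/n; m<n*o⇒m/o<n)
open import Data.Parity.Base as ℙ using (Parity; 0ℙ; 1ℙ)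
open import Data.Parity.Properties using (p≢p⁻¹; suc-homo-⁻¹)
open import Data.Fin.Base using (Fin; zero; suc; toℕ; fromℕ; fromℕ<; inject₁; combine)
open import Data.Fin.Properties
  using (any?; all?; toℕ<n; toℕ-injective; toℕ-fromℕ<; fromℕ<-injective; ¬∀⟶∃¬;
         injective⇒≤; combine-injective; inject₁-injective; fromℕ≢inject₁; *↔×)
  renaming (_≟_ to _≟ᶠ_)
open import Data.Vec.Base using (Vec; []; _∷_; lookup; tabulate)
open import Data.Vec.Properties using (lookup∘tabulate)
open import Data.List.Base as List using (List; []; _∷_; filter; length)
open import Data.List.Properties using (filter-notAll; length-tabulate)
open import Data.List.Membership.Propositional using (_∈_)
open import Data.List.Membership.Propositional.Properties using (∈-tabulate⁺)
open import Data.List.Relation.Unary.Any as Any using (here; there)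
open import Data.Product using (Σ; ∃; ∃₂; _×_; _,_; proj₁; proj₂; swap)
import Data.Product as Product
open import Data.Sum using (_⊎_; inj₁; inj₂; [_,_]′)
import Data.Sum as Sum
open import Function using (id; _∘_; _↔_; Inverse)
open import Function.Properties.Inverse using (↔-sym)
open import Function.Definitions using (Injective)
open import Relation.Unary using (Pred; Decidable; _⊆_)
open import Relation.Nullary using (Dec; yes; no; ¬_; contradiction)
open import Relation.Nullary.Decidable using (map′; _×-dec_; _⊎-dec_; _→-dec_; toWitness)
open import Relation.Binary.Definitions using (tri<; tri≈; tri>)
open import Relation.Binary.PropositionalEquality
  using (_≡_; _≢_; _≗_; refl; sym; trans; cong; cong₂; subst; subst₂; module ≡-Reasoning)

Dist1-suc⁺ : ∀ {x y} → Dist1 x y → Dist1 (suc x) (suc y)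
Dist1-suc⁺ = Sum.map (cong suc) (cong suc)

Dist1-suc⁻ : ∀ {x y} → Dist1 (suc x) (suc y) → Dist1 x y
Dist1-suc⁻ = Sum.map suc-injective suc-injective

Dist1? : ∀ x y → Dec (Dist1 x y)
Dist1? x y = (suc x ≟ y) ⊎-dec (suc y ≟ x)

Near : ℕ → ℕ → Set
Near x y = x ≤ suc y × y ≤ suc x

Dist1⇒Near : ∀ {x y} → Dist1 x y → Near x y
Dist1⇒Near {x} (inj₁ refl) = m≤n⇒m≤1+n (n≤1+n x) , ≤-refl
Dist1⇒Near {y = y} (inj₂ refl) = ≤-refl , m≤n⇒m≤1+n (n≤1+n y)

≡⇒Near : ∀ {x y} → x ≡ y → Near x y
≡⇒Near {x} refl = n≤1+n x , n≤1+n x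

bit : Parity → Fin 2
bit 0ℙ = zero
bit 1ℙ = suc zero

bit-injective : ∀ {p q} → bit p ≡ bit q → p ≡ q
bit-injective {0ℙ} {0ℙ} _ = refl
bit-injective {1ℙ} {1ℙ} _ = refl

bit≤1 : ∀ p → toℕ (bit p) ≤ 1
bit≤1 p = s≤s⁻¹ (toℕ<n (bit p))

parity-suc≢ : ∀ n → parity (suc n) ≢ parity n
parity-suc≢ n eq = p≢p⁻¹ (parity (suc n)) (trans eq (sym (suc-homo-⁻¹ n)))

Dist1⇒parity≢ : ∀ {x y} → Dist1 x y → parity x ≢ parity y
Dist1⇒parity≢ {x} (inj₁ refl) = parity-suc≢ x ∘ sym
Dist1⇒parity≢ {y = y} (inj₂ refl) = parity-suc≢ y

period-2-induction : (P : ℕ → Set) (b : ℕ) → (∀ {i} → i < 2 + b → P i) →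
                     (∀ {i} → b ≤ i → P i → P (2 + i)) → ∀ i → P i
period-2-induction P b base step 0 = base z<s
period-2-induction P b base step 1 = base (s<s z<s)
period-2-induction P b base step (suc (suc i)) with b ≤? i
... | yes b≤i = step b≤i (period-2-induction P b base step i)
... | no  b≰i = base (s<s (s<s (≰⇒> b≰i)))

least-witness : {P : ℕ → Set} → Decidable P → ∀ {u} → P u →
                Σ ℕ λ t → P t × (∀ k → P k → t ≤ k)
least-witness P? {u} Pu with P? 0
... | yes P0 = 0 , P0 , λ _ _ → z≤n
least-witness P? {zero} P0 | no ¬P0 = contradiction P0 ¬P0
least-witness P? {suc u} Pu | no ¬P0 with least-witness (P? ∘ suc) Pu
... | t , Pt , least = suc t , Pt , λ
  { zero    P0 → contradiction P0 ¬P0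
  ; (suc k) Pk → s≤s (least k Pk) }

*+-monoˡ-< : ∀ {s t x y n} → s < t → x < n → s * n + x < t * n + y
*+-monoˡ-< {s} {t} {x} {y} {n} s<t x<n = begin-strict
  s * n + x   <⟨ +-monoʳ-< (s * n) x<n ⟩
  s * n + n   ≡⟨ +-comm (s * n) n ⟩
  suc s * n   ≤⟨ *-monoˡ-≤ n s<t ⟩
  t * n       ≤⟨ m≤m+n (t * n) y ⟩
  t * n + y   ∎
  where open ≤-Reasoning

*+-reflects-lex : ∀ {s t x y n} → x < n → y < n → s * n + x < t * n + y →
                  s < t ⊎ (s ≡ t × x < y)
*+-reflects-lex {s} {t} {x} {y} {n} x<n y<n lt with <-cmp s t
... | tri< s<t _ _ = inj₁ s<t
... | tri≈ _ refl _ = inj₂ (refl , +-cancelˡ-< (s * n) x y lt)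
... | tri> _ _ t<s = contradiction lt (<-asym (*+-monoˡ-< t<s y<n))

*+-injective : ∀ {s t x y n} → x < n → y < n → s * n + x ≡ t * n + y → s ≡ t × x ≡ y
*+-injective {s} {t} {x} {y} {n} x<n y<n eq with <-cmp s t
... | tri< s<t _ _ = contradiction eq (<⇒≢ (*+-monoˡ-< s<t x<n))
... | tri≈ _ refl _ = refl , +-cancelˡ-≡ (s * n) x y eq
... | tri> _ _ t<s = contradiction (sym eq) (<⇒≢ (*+-monoˡ-< t<s y<n))

Switch : ∀ {n} → Pred (Fin n) 0ℓ → Set
Switch P = ∃₂ λ z z′ → Dist1 (toℕ z) (toℕ z′) × P z × ¬ P z′

Switch-suc : ∀ {n} {P : Pred (Fin (suc n)) 0ℓ} → Switch (P ∘ suc) → Switch P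
Switch-suc (z , z′ , z~z′ , Pz , ¬Pz′) = suc z , suc z′ , Dist1-suc⁺ z~z′ , Pz , ¬Pz′

switch : ∀ {n} {P : Pred (Fin n) 0ℓ} → Decidable P → ∀ {x y} → P x → ¬ P y → Switch P
switch P? {zero} {zero} Px ¬Py = contradiction Px ¬Py
switch P? {suc x} {suc y} Px ¬Py = Switch-suc (switch (P? ∘ suc) Px ¬Py)
switch {suc zero} P? {zero} {suc ()}
switch {suc (suc n)} P? {zero} {suc y} P0 ¬Py with P? (suc zero)
... | no ¬P1 = zero , suc zero , inj₁ refl , P0 , ¬P1
... | yes P1 = Switch-suc (switch (P? ∘ suc) {zero} {y} P1 ¬Py)
switch {suc zero} P? {suc ()} {zero}
switch {suc (suc n)} P? {suc x} {zero} Px ¬P0 with P? (suc zero)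
... | yes P1 = suc zero , zero , inj₂ refl , P1 , ¬P0
... | no ¬P1 = Switch-suc (switch (P? ∘ suc) {x} {zero} Px ¬P1)

Searchable : Set → Set₁
Searchable A = {P : Pred A 0ℓ} → Decidable P → Dec (∃ P)

Vec-searchable : ∀ {A} → Searchable A → ∀ n → Searchable (Vec A n)
Vec-searchable search zero P? with P? []
... | yes P[] = yes ([] , P[])
... | no ¬P[] = no λ { ([] , P[]) → ¬P[] P[] }
Vec-searchable search (suc n) P? with search (λ x → Vec-searchable search n (P? ∘ (x ∷_)))
... | yes (x , xs , Pxxs) = yes (x ∷ xs , Pxxs)
... | no ¬∃ = no λ { (x ∷ xs , Pxxs) → ¬∃ (x , xs , Pxxs) }

module _ {A : Set} {P Q : Pred A 0ℓ} (P? : Decidable P) (Q? : Decidable Q) (P⊆Q : P ⊆ Q) where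

  filter-length-mono : ∀ xs → length (filter P? xs) ≤ length (filter Q? xs)
  filter-length-mono [] = z≤n
  filter-length-mono (x ∷ xs) with P? x | Q? x
  ... | yes _  | yes _  = s≤s (filter-length-mono xs)
  ... | yes Px | no ¬Qx = contradiction (P⊆Q Px) ¬Qx
  ... | no _   | yes _  = m≤n⇒m≤1+n (filter-length-mono xs)
  ... | no _   | no _   = filter-length-mono xs

  filter-length-strict : ∀ {x xs} → x ∈ xs → ¬ P x → Q x →
                         length (filter P? xs) < length (filter Q? xs)
  filter-length-strict {xs = y ∷ xs} (here refl) ¬Px Qx with P? y | Q? y
  ... | yes Px | _      = contradiction Px ¬Px
  ... | no _   | yes _  = s≤s (filter-length-mono xs)
  ... | no _   | no ¬Qx = contradiction Qx ¬Qx
  filter-length-strict {xs = y ∷ xs} (there x∈xs) ¬Px Qx with P? y | Q? y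
  ... | yes _  | yes _  = s≤s (filter-length-strict x∈xs ¬Px Qx)
  ... | yes Py | no ¬Qy = contradiction (P⊆Q Py) ¬Qy
  ... | no _   | yes _  = m≤n⇒m≤1+n (filter-length-strict x∈xs ¬Px Qx)
  ... | no _   | no _   = filter-length-strict x∈xs ¬Px Qx

IsThin : (G : Graph) {k : ℕ} → (V G → ℕ) → (V G → Fin k) → Set
IsThin G rank cls = Injective _≡_ _≡_ rank × Consistent G rank cls

IsThin-cong : ∀ G {k} {rank rank′ : V G → ℕ} {cls cls′ : V G → Fin k} →
              rank ≗ rank′ → cls ≗ cls′ → IsThin G rank cls → IsThin G rank′ cls′
IsThin-cong G {rank = rank} {rank′} {cls} {cls′} rank≗ cls≗ (injective , consistent) =
  (λ {x} {y} eq → injective (trans (rank≗ x) (trans eq (sym (rank≗ y))))) ,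
  λ p q r p<q q<r same → consistent p q r
    (subst₂ _<_ (sym (rank≗ p)) (sym (rank≗ q)) p<q)
    (subst₂ _<_ (sym (rank≗ q)) (sym (rank≗ r)) q<r)
    (trans (cls≗ p) (trans same (sym (cls≗ q))))

module FiniteGraph (G : Graph) {N : ℕ} (enumeration : V G ↔ Fin N)
                   (Adj? : ∀ p q → Dec (Adj G p q)) where

  open Inverse enumeration using (to; from; strictlyInverseʳ)

  ∀? : {P : Pred (V G) 0ℓ} → Decidable P → Dec (∀ v → P v)
  ∀? {P} P? = map′ (λ ∀P v → subst P (strictlyInverseʳ v) (∀P (to v))) (λ ∀P → ∀P ∘ from)
                   (all? (P? ∘ from))

  _≟ᵛ_ : (u v : V G) → Dec (u ≡ v)
  u ≟ᵛ v = map′ (λ eq → trans (sym (strictlyInverseʳ u)) (trans (cong from eq) (strictlyInverseʳ v)))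
                (cong to) (to u ≟ᶠ to v)

  IsThin? : ∀ {k} (rank : V G → ℕ) (cls : V G → Fin k) → Dec (IsThin G rank cls)
  IsThin? rank cls =
    map′ (λ inj {u} {v} → inj u v) (λ inj u v → inj)
         (∀? λ u → ∀? λ v → (rank u ≟ rank v) →-dec (u ≟ᵛ v)) ×-dec
    (∀? λ p → ∀? λ q → ∀? λ r → (rank p <? rank q) →-dec ((rank q <? rank r) →-dec
      ((cls p ≟ᶠ cls q) →-dec (Adj? p r →-dec Adj? q r))))

  vertices : List (V G)
  vertices = List.tabulate from

  ∈-vertices : ∀ v → v ∈ vertices
  ∈-vertices v = subst (_∈ vertices) (strictlyInverseʳ v) (∈-tabulate⁺ (to v))

  module _ (rank : V G → ℕ) where

    below : V G → ℕ
    below v = length (filter (λ u → rank u <? rank v) vertices)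

    below<N : ∀ v → below v < N
    below<N v = subst (below v <_) (length-tabulate from)
      (filter-notAll (λ u → rank u <? rank v) vertices
        (Any.map (λ { refl → <-irrefl refl }) (∈-vertices v)))

    below-mono-< : ∀ {u v} → rank u < rank v → below u < below v
    below-mono-< {u} {v} u<v =
      filter-length-strict (λ w → rank w <? rank u) (λ w → rank w <? rank v)
        (λ w<u → <-trans w<u u<v) (∈-vertices u) (<-irrefl refl) u<v

    module _ (rank-injective : Injective _≡_ _≡_ rank) where

      below-reflects-< : ∀ {u v} → below u < below v → rank u < rank v
      below-reflects-< {u} {v} lt with <-cmp (rank u) (rank v)
      ... | tri< u<v _ _ = u<v
      ... | tri≈ _ eq _ = contradiction (cong below (rank-injective eq)) (<⇒≢ lt)
      ... | tri> _ _ v<u = contradiction lt (<-asym (below-mono-< v<u))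

      below-injective : Injective _≡_ _≡_ below
      below-injective {u} {v} eq with <-cmp (rank u) (rank v)
      ... | tri< u<v _ _ = contradiction eq (<⇒≢ (below-mono-< u<v))
      ... | tri≈ _ eq′ _ = rank-injective eq′
      ... | tri> _ _ v<u = contradiction (sym eq) (<⇒≢ (below-mono-< v<u))

  NormalThin : ℕ → Set
  NormalThin k = ∃₂ λ (ranks : Vec (Fin N) N) (classes : Vec (Fin k) N) →
                 IsThin G (toℕ ∘ lookup ranks ∘ to) (lookup classes ∘ to)

  normalise : ∀ {k} → KThin G k → NormalThin k
  normalise {k} (rank , injective , cls , consistent) =
    ranks , classes , IsThin-cong G rank≗ cls≗
      (below-injective rank injective , λ p q r p<q q<r →
        consistent p q r (below-reflects-< rank injective p<q) (below-reflects-< rank injective q<r))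
    where
    ranks : Vec (Fin N) N
    ranks = tabulate (λ i → fromℕ< (below<N rank (from i)))
    classes : Vec (Fin k) N
    classes = tabulate (cls ∘ from)
    rank≗ : below rank ≗ toℕ ∘ lookup ranks ∘ to
    rank≗ v = sym (begin
      toℕ (lookup ranks (to v))                  ≡⟨ cong toℕ (lookup∘tabulate _ (to v)) ⟩
      toℕ (fromℕ< (below<N rank (from (to v))))  ≡⟨ toℕ-fromℕ< _ ⟩
      below rank (from (to v))                   ≡⟨ cong (below rank) (strictlyInverseʳ v) ⟩
      below rank v                               ∎)
      where open ≡-Reasoning
    cls≗ : cls ≗ lookup classes ∘ to
    cls≗ v = sym (trans (lookup∘tabulate _ (to v)) (cong cls (strictlyInverseʳ v)))

  NormalThin⇒KThin : ∀ {k} → NormalThin k → KThin G k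
  NormalThin⇒KThin (ranks , classes , injective , consistent) =
    toℕ ∘ lookup ranks ∘ to , injective , lookup classes ∘ to , consistent

  bounded-witness : ∀ {k} → KThin G k → Σ (KThin G k) λ w → ∀ v → proj₁ w v < N
  bounded-witness thin with ranks , normal ← normalise thin =
    NormalThin⇒KThin (ranks , normal) , λ v → toℕ<n (lookup ranks (to v))

  KThin? : ∀ k → Dec (KThin G k)
  KThin? k = map′ NormalThin⇒KThin normalise
    (Vec-searchable any? N λ ranks → Vec-searchable any? N λ classes →
      IsThin? (toℕ ∘ lookup ranks ∘ to) (lookup classes ∘ to))

Cell : Set
Cell = ℕ × ℕ

Adjacent : Cell → Cell → Set
Adjacent (i , j) (k , l) = (i ≡ k × Dist1 j l) ⊎ (Dist1 i k × j ≡ l)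

Adjacent? : ∀ p q → Dec (Adjacent p q)
Adjacent? (i , j) (k , l) = ((i ≟ k) ×-dec Dist1? j l) ⊎-dec (Dist1? i k ×-dec (j ≟ l))

Adjacent⇒Near : ∀ {i j k l} → Adjacent (i , j) (k , l) → Near i k × Near j l
Adjacent⇒Near (inj₁ (i≡k , j~l)) = ≡⇒Near i≡k , Dist1⇒Near j~l
Adjacent⇒Near (inj₂ (i~k , j≡l)) = Dist1⇒Near i~k , ≡⇒Near j≡l

-- Cells are swept phase by phase: phase p consists of the cells (i , p) with i odd and
-- (i , p - 1) with i even.  Inside a phase the sweep runs down the rows when p is even
-- and up the rows when p is odd.
phase : Cell → ℕ
phase (i , j) = j + toℕ (bit (parity i ℙ.⁻¹))

Sweep : Parity → ℕ → ℕ → Set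
Sweep 0ℙ i a = i < a
Sweep 1ℙ i a = a < i

Sweep? : ∀ s i a → Dec (Sweep s i a)
Sweep? 0ℙ i a = i <? a
Sweep? 1ℙ i a = a <? i

infix 4 _≺_
_≺_ : Cell → Cell → Set
p ≺ q = phase p < phase q ⊎ (phase p ≡ phase q × Sweep (parity (phase p)) (proj₁ p) (proj₁ q))

_≺?_ : ∀ p q → Dec (p ≺ q)
p ≺? q = (phase p <? phase q) ⊎-dec
         ((phase p ≟ phase q) ×-dec Sweep? (parity (phase p)) (proj₁ p) (proj₁ q))

class : Cell → ℕ
class (i , j) = ⌊ i /2⌋ + toℕ (bit (parity i ℙ.* parity j))

ConsistentTriple : Cell → Cell → Cell → Set
ConsistentTriple p q r = p ≺ q → q ≺ r → class p ≡ class q → Adjacent p r → Adjacent q r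

ConsistentTriple? : ∀ p q r → Dec (ConsistentTriple p q r)
ConsistentTriple? p q r =
  (p ≺? q) →-dec ((q ≺? r) →-dec ((class p ≟ class q) →-dec (Adjacent? p r →-dec Adjacent? q r)))

phase-≥ : ∀ i j → j ≤ phase (i , j)
phase-≥ i j = m≤m+n j _

phase-≤ : ∀ i j → phase (i , j) ≤ suc j
phase-≤ i j = ≤-trans (+-monoʳ-≤ j (bit≤1 _)) (≤-reflexive (+-comm j 1))

≺⇒phase≤ : ∀ {p q} → p ≺ q → phase p ≤ phase q
≺⇒phase≤ (inj₁ lt) = <⇒≤ lt
≺⇒phase≤ (inj₂ (eq , _)) = ≤-reflexive eq

class≤ : ∀ i j → class (i , j) ≤ suc ⌊ i /2⌋
class≤ i j = ≤-trans (+-monoʳ-≤ ⌊ i /2⌋ (bit≤1 _)) (≤-reflexive (+-comm ⌊ i /2⌋ 1))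

class-near : ∀ i j a b → class (i , j) ≡ class (a , b) → a ≤ 3 + i
class-near i j a b eq = ≮⇒≥ λ 3+i<a → 1+n≰n (begin
  suc (suc ⌊ i /2⌋)  ≤⟨ ⌊n/2⌋-mono 3+i<a ⟩
  ⌊ a /2⌋            ≤⟨ m≤m+n ⌊ a /2⌋ _ ⟩
  class (a , b)      ≡⟨ sym eq ⟩
  class (i , j)      ≤⟨ class≤ i j ⟩
  suc ⌊ i /2⌋        ∎)
  where open ≤-Reasoning

shiftRows shiftCols : Cell → Cell
shiftRows (i , j) = (2 + i , j)
shiftCols (i , j) = (i , 2 + j)

consistent-transport :
  (f : Cell → Cell) →
  (∀ {p r} → Adjacent p r → Adjacent (f p) (f r)) →
  (∀ {p r} → Adjacent (f p) (f r) → Adjacent p r) →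
  (∀ {p q} → f p ≺ f q → p ≺ q) →
  (∀ {p q} → class (f p) ≡ class (f q) → class p ≡ class q) →
  ∀ p q r → ConsistentTriple p q r → ConsistentTriple (f p) (f q) (f r)
consistent-transport f adj⁺ adj⁻ ≺⁻ class⁻ p q r consistent fp≺fq fq≺fr same adj =
  adj⁺ (consistent (≺⁻ fp≺fq) (≺⁻ fq≺fr) (class⁻ same) (adj⁻ adj))

-- shifting by two rows or two columns preserves parities, hence phases, sweeps and classes
consistent-shiftRows : ∀ p q r → ConsistentTriple p q r →
                       ConsistentTriple (shiftRows p) (shiftRows q) (shiftRows r)
consistent-shiftRows = consistent-transport shiftRows
  (Sum.map (Product.map (cong (2 +_)) id) (Product.map (Dist1-suc⁺ ∘ Dist1-suc⁺) id))
  (Sum.map (Product.map (suc-injective ∘ suc-injective) id)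
           (Product.map (Dist1-suc⁻ ∘ Dist1-suc⁻) id))
  ≺⁻ suc-injective
  where
  sweep⁻ : ∀ s {i a} → Sweep s (2 + i) (2 + a) → Sweep s i a
  sweep⁻ 0ℙ = s<s⁻¹ ∘ s<s⁻¹
  sweep⁻ 1ℙ = s<s⁻¹ ∘ s<s⁻¹
  ≺⁻ : ∀ {p q} → shiftRows p ≺ shiftRows q → p ≺ q
  ≺⁻ (inj₁ lt) = inj₁ lt
  ≺⁻ {p} (inj₂ (eq , sweep)) = inj₂ (eq , sweep⁻ (parity (phase p)) sweep)

consistent-shiftCols : ∀ p q r → ConsistentTriple p q r →
                       ConsistentTriple (shiftCols p) (shiftCols q) (shiftCols r)
consistent-shiftCols = consistent-transport shiftCols
  (Sum.map (Product.map id (Dist1-suc⁺ ∘ Dist1-suc⁺)) (Product.map id (cong (2 +_))))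
  (Sum.map (Product.map id (Dist1-suc⁻ ∘ Dist1-suc⁻))
           (Product.map id (suc-injective ∘ suc-injective)))
  ≺⁻ id
  where
  ≺⁻ : ∀ {p q} → shiftCols p ≺ shiftCols q → p ≺ q
  ≺⁻ (inj₁ lt) = inj₁ (s<s⁻¹ (s<s⁻¹ lt))
  ≺⁻ (inj₂ (eq , sweep)) = inj₂ (suc-injective (suc-injective eq) , sweep)

consistent-box : ∀ {i} → i < 5 → ∀ {j} → j < 3 → ∀ {a} → a < 8 → ∀ {b} → b < 5 →
                 ∀ {k} → k < 6 → ∀ {l} → l < 4 → ConsistentTriple (i , j) (a , b) (k , l)
consistent-box = toWitness {a? =
  allUpTo? (λ i → allUpTo? (λ j → allUpTo? (λ a → allUpTo? (λ b → allUpTo? (λ k → allUpTo? (λ l →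
    ConsistentTriple? (i , j) (a , b) (k , l)) 4) 6) 5) 8) 3) 5} _

consistent-window : ∀ {i j} → i < 5 → j < 3 → ∀ q r → ConsistentTriple (i , j) q r
consistent-window {i} {j} i<5 j<3 (a , b) (k , l) p≺q q≺r same adj =
  consistent-box i<5 j<3 a<8 b<5 k<6 l<4 p≺q q≺r same adj
  where
  i≤4 : i ≤ 4
  i≤4 = s≤s⁻¹ i<5
  j≤2 : j ≤ 2
  j≤2 = s≤s⁻¹ j<3
  near : Near i k × Near j l
  near = Adjacent⇒Near adj
  l≤3 : l ≤ 3
  l≤3 = ≤-trans (proj₂ (proj₂ near)) (s≤s j≤2)
  a<8 : a < 8
  a<8 = s≤s (≤-trans (class-near i j a b same) (+-monoʳ-≤ 3 i≤4))
  b<5 : b < 5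
  b<5 = s≤s (begin
    b              ≤⟨ phase-≥ a b ⟩
    phase (a , b)  ≤⟨ ≺⇒phase≤ q≺r ⟩
    phase (k , l)  ≤⟨ phase-≤ k l ⟩
    suc l          ≤⟨ s≤s l≤3 ⟩
    4              ∎)
    where open ≤-Reasoning
  k<6 : k < 6
  k<6 = s≤s (≤-trans (proj₂ (proj₁ near)) (s≤s i≤4))
  l<4 : l < 4
  l<4 = s≤s l≤3

rowStep-bounds : ∀ {i j a b k l} → 3 ≤ i → class (2 + i , j) ≡ class (a , b) →
                 Adjacent (2 + i , j) (k , l) → 2 ≤ a × 2 ≤ k
rowStep-bounds {i} {j} {a} {b} 3≤i same adj =
  s≤s⁻¹ (≤-trans 3≤i (s≤s⁻¹ (s≤s⁻¹ (class-near a b (2 + i) j (sym same))))) ,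
  ≤-trans 2≤i (≤-trans (n≤1+n i) (s≤s⁻¹ (proj₁ (proj₁ (Adjacent⇒Near adj)))))
  where
  2≤i : 2 ≤ i
  2≤i = ≤-trans (n≤1+n 2) 3≤i

colStep-bounds : ∀ {i j a b k l} → 1 ≤ j → (i , 2 + j) ≺ (a , b) →
                 Adjacent (i , 2 + j) (k , l) → 2 ≤ b × 2 ≤ l
colStep-bounds {i} {j} {a} {b} 1≤j p≺q adj =
  ≤-trans (s≤s 1≤j) (s≤s⁻¹ (begin
    2 + j              ≤⟨ phase-≥ i (2 + j) ⟩
    phase (i , 2 + j)  ≤⟨ ≺⇒phase≤ p≺q ⟩
    phase (a , b)      ≤⟨ phase-≤ a b ⟩
    suc b              ∎)) ,
  ≤-trans (s≤s 1≤j) (s≤s⁻¹ (proj₁ (proj₂ (Adjacent⇒Near adj))))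
  where open ≤-Reasoning

consistent-rowStep : ∀ {i} → 3 ≤ i → (∀ j q r → ConsistentTriple (i , j) q r) →
                     ∀ j q r → ConsistentTriple (2 + i , j) q r
consistent-rowStep {i} 3≤i consistent j (a , b) (k , l) p≺q q≺r same adj
  with 2≤a , 2≤k ← rowStep-bounds {i} {j} {a} {b} {k} {l} 3≤i same adj
  with a′ , refl ← m≤n⇒∃[o]m+o≡n 2≤a | k′ , refl ← m≤n⇒∃[o]m+o≡n 2≤k =
  consistent-shiftRows (i , j) (a′ , b) (k′ , l) (consistent j (a′ , b) (k′ , l)) p≺q q≺r same adj

consistent-colStep : ∀ {i j} → 1 ≤ j → (∀ q r → ConsistentTriple (i , j) q r) →
                     ∀ q r → ConsistentTriple (i , 2 + j) q r
consistent-colStep {i} {j} 1≤j consistent (a , b) (k , l) p≺q q≺r same adj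
  with 2≤b , 2≤l ← colStep-bounds {i} {j} {a} {b} {k} {l} 1≤j p≺q adj
  with b′ , refl ← m≤n⇒∃[o]m+o≡n 2≤b | l′ , refl ← m≤n⇒∃[o]m+o≡n 2≤l =
  consistent-shiftCols (i , j) (a , b′) (k , l′) (consistent (a , b′) (k , l′)) p≺q q≺r same adj

consistent : ∀ p q r → ConsistentTriple p q r
consistent (i , j) = period-2-induction (λ i → ∀ j q r → ConsistentTriple (i , j) q r) 3
  (λ i<5 → period-2-induction (λ j → ∀ q r → ConsistentTriple (_ , j) q r) 1
             (consistent-window i<5) consistent-colStep)
  consistent-rowStep i j

GR-Adj? : ∀ {n m} (p q : Fin n × Fin m) → Dec (Adj (GR n m) p q)
GR-Adj? (i , j) (k , l) = Adjacent? (toℕ i , toℕ j) (toℕ k , toℕ l)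

module GridGraph (n m : ℕ) = FiniteGraph (GR n m) (↔-sym (*↔× {n} {m})) GR-Adj?

position : Parity → ℕ → ℕ → ℕ
position 0ℙ n i = i
position 1ℙ n i = n ∸ suc i

position-< : ∀ s {n i} → i < n → position s n i < n
position-< 0ℙ i<n = i<n
position-< 1ℙ {suc n} {i} i<n = s≤s (m∸n≤m n i)

position-reflects : ∀ s {n i a} → i < n → a < n → position s n i < position s n a → Sweep s i a
position-reflects 0ℙ i<n a<n lt = lt
position-reflects 1ℙ {n} i<n a<n lt = ≰⇒> λ i≤a → <⇒≱ lt (∸-monoʳ-≤ n (s≤s i≤a))

position-injective : ∀ s {n i a} → i < n → a < n → position s n i ≡ position s n a → i ≡ a
position-injective 0ℙ i<n a<n eq = eq
position-injective 1ℙ i<n a<n eq = suc-injective (∸-cancelˡ-≡ i<n a<n eq)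

sweepRank : ℕ → ℕ → ℕ → ℕ
sweepRank n s i = s * n + position (parity s) n i

sweepRank-reflects : ∀ {n} s t {i a} → i < n → a < n → sweepRank n s i < sweepRank n t a →
                     s < t ⊎ (s ≡ t × Sweep (parity s) i a)
sweepRank-reflects s t i<n a<n lt
  with *+-reflects-lex {s} {t} (position-< (parity s) i<n) (position-< (parity t) a<n) lt
... | inj₁ s<t = inj₁ s<t
... | inj₂ (refl , position<) = inj₂ (refl , position-reflects (parity s) i<n a<n position<)

sweepRank-injective : ∀ {n} s t {i a} → i < n → a < n → sweepRank n s i ≡ sweepRank n t a →
                      s ≡ t × i ≡ a
sweepRank-injective s t i<n a<n eq
  with *+-injective {s} {t} (position-< (parity s) i<n) (position-< (parity t) a<n) eq
... | refl , position≡ = refl , position-injective (parity s) i<n a<n position≡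

bit-*-≤ : ∀ p q → toℕ (bit (p ℙ.* q)) ≤ toℕ (bit p)
bit-*-≤ 0ℙ q = z≤n
bit-*-≤ 1ℙ q = bit≤1 q

⌊n/2⌋+parity≡⌊1+n/2⌋ : ∀ n → ⌊ n /2⌋ + toℕ (bit (parity n)) ≡ ⌊ suc n /2⌋
⌊n/2⌋+parity≡⌊1+n/2⌋ 0 = refl
⌊n/2⌋+parity≡⌊1+n/2⌋ 1 = refl
⌊n/2⌋+parity≡⌊1+n/2⌋ (suc (suc n)) = cong suc (⌊n/2⌋+parity≡⌊1+n/2⌋ n)

class<1+⌊n/2⌋ : ∀ {n i} j → i < n → class (i , j) < suc ⌊ n /2⌋
class<1+⌊n/2⌋ {n} {i} j i<n = s≤s (begin
  class (i , j)                   ≤⟨ +-monoʳ-≤ ⌊ i /2⌋ (bit-*-≤ (parity i) (parity j)) ⟩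
  ⌊ i /2⌋ + toℕ (bit (parity i))  ≡⟨ ⌊n/2⌋+parity≡⌊1+n/2⌋ i ⟩
  ⌊ suc i /2⌋                     ≤⟨ ⌊n/2⌋-mono i<n ⟩
  ⌊ n /2⌋                         ∎)
  where open ≤-Reasoning

grid-thin : ∀ n m → KThin (GR n m) (suc ⌊ n /2⌋)
grid-thin n m = rank , rank-injective , cls , cls-consistent
  where
  cell : Fin n × Fin m → Cell
  cell (i , j) = toℕ i , toℕ j
  rank : Fin n × Fin m → ℕ
  rank p = sweepRank n (phase (cell p)) (proj₁ (cell p))
  cls : Fin n × Fin m → Fin (suc ⌊ n /2⌋)
  cls (i , j) = fromℕ< (class<1+⌊n/2⌋ (toℕ j) (toℕ<n i))
  rank-injective : Injective _≡_ _≡_ rank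
  rank-injective {i , j} {a , b} eq
    with phase≡ , i≡a ← sweepRank-injective (phase (cell (i , j))) (phase (cell (a , b)))
                                            (toℕ<n i) (toℕ<n a) eq
    with refl ← toℕ-injective i≡a =
    cong (i ,_) (toℕ-injective (+-cancelʳ-≡ (toℕ (bit (parity (toℕ i) ℙ.⁻¹))) (toℕ j) (toℕ b) phase≡))
  cls-consistent : Consistent (GR n m) rank cls
  cls-consistent p@(i , _) q@(a , _) r@(k , _) p<q q<r same =
    consistent (cell p) (cell q) (cell r)
      (sweepRank-reflects _ _ (toℕ<n i) (toℕ<n a) p<q)
      (sweepRank-reflects _ _ (toℕ<n a) (toℕ<n k) q<r)
      (fromℕ<-injective _ _ _ _ same)

GR-transpose : ∀ {n m k} → KThin (GR n m) k → KThin (GR m n) k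
GR-transpose (rank , injective , cls , consistent) =
  rank ∘ swap , cong swap ∘ injective , cls ∘ swap ,
  λ { (j , i) (b , a) (l , k) p<q q<r same adj →
      transposeAdj (consistent (i , j) (a , b) (k , l) p<q q<r same (transposeAdj adj)) }
  where
  transposeAdj : ∀ {A B C D : Set} → (A × B) ⊎ (C × D) → (D × C) ⊎ (B × A)
  transposeAdj = Sum.swap ∘ Sum.map swap swap

module _ {n m k} (rank : Fin n × Fin m → ℕ) (rank-injective : Injective _≡_ _≡_ rank)
         (cls : Fin n × Fin m → Fin k) (consistent : Consistent (GR n m) rank cls) (s : ℕ) where

  RowCrossing : Fin n → Set
  RowCrossing i = ∃₂ λ z z′ → Dist1 (toℕ z) (toℕ z′) × rank (i , z) < s × s ≤ rank (i , z′)

  rowCrossing : ∀ {i j j′} → rank (i , j) < s → s ≤ rank (i , j′) → RowCrossing i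
  rowCrossing {i} low high with switch (λ j → rank (i , j) <? s) low (≤⇒≯ high)
  ... | z , z′ , z~z′ , low-z , ¬low-z′ = z , z′ , z~z′ , low-z , ≮⇒≥ ¬low-z′

  -- (i′ , w) lies strictly between the adjacent cells (i , z) and (i , z′) in the order,
  -- so consistency makes (i′ , w) adjacent to (i , z′): rows i and i′ are equal or neighbours.
  rowCrossing-collision : ∀ {i i′} (c : RowCrossing i) (c′ : RowCrossing i′) →
                          rank (i , proj₁ c) < rank (i′ , proj₁ c′) →
                          cls (i , proj₁ c) ≡ cls (i′ , proj₁ c′) →
                          parity (toℕ i) ≡ parity (toℕ i′) → i ≡ i′
  rowCrossing-collision {i} {i′} (z , z′ , z~z′ , _ , high) (w , _ , _ , low , _) z<w same parity≡
    with consistent (i , z) (i′ , w) (i , z′) z<w (<-≤-trans low high) same (inj₁ (refl , z~z′))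
  ... | inj₁ (i′≡i , _) = sym (toℕ-injective i′≡i)
  ... | inj₂ (i′~i , _) = contradiction (sym parity≡) (Dist1⇒parity≢ i′~i)

  rowCrossing-injective : ∀ {i i′} (c : RowCrossing i) (c′ : RowCrossing i′) →
                          cls (i , proj₁ c) ≡ cls (i′ , proj₁ c′) →
                          parity (toℕ i) ≡ parity (toℕ i′) → i ≡ i′
  rowCrossing-injective {i} {i′} c c′ same parity≡
    with <-cmp (rank (i , proj₁ c)) (rank (i′ , proj₁ c′))
  ... | tri< lt _ _ = rowCrossing-collision c c′ lt same parity≡
  ... | tri≈ _ eq _ = cong proj₁ (rank-injective eq)
  ... | tri> _ _ gt = sym (rowCrossing-collision c′ c gt (sym same) (sym parity≡))

  -- Rows with a crossing are labelled by the class of their low cell and their parity;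
  -- the only other row is the one ranked exactly s in column j₀.
  rows≤ : (j₀ : Fin m) → (∀ i → rank (i , j₀) ≤ s) → (∀ i → ∃ λ j → s ≤ rank (i , j)) →
          n ≤ suc (k * 2)
  rows≤ j₀ column≤s row≥s = injective⇒≤ λ {i} {i′} → label-injective i i′ (low? i) (low? i′)
    where
    low? : ∀ i → Dec (rank (i , j₀) < s)
    low? i = rank (i , j₀) <? s
    crossingOf : ∀ {i} → rank (i , j₀) < s → RowCrossing i
    crossingOf {i} low = rowCrossing low (proj₂ (row≥s i))
    label : ∀ i → Dec (rank (i , j₀) < s) → Fin (suc (k * 2))
    label i (yes low) = inject₁ (combine (cls (i , proj₁ (crossingOf low))) (bit (parity (toℕ i))))
    label i (no _) = fromℕ (k * 2)
    label-injective : ∀ i i′ d d′ → label i d ≡ label i′ d′ → i ≡ i′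
    label-injective i i′ (yes low) (yes low′) eq
      with same , parity≡ ← combine-injective _ _ _ _ (inject₁-injective eq) =
      rowCrossing-injective (crossingOf low) (crossingOf low′) same (bit-injective parity≡)
    label-injective i i′ (yes _) (no _) eq = contradiction (sym eq) fromℕ≢inject₁
    label-injective i i′ (no _) (yes _) eq = contradiction eq fromℕ≢inject₁
    label-injective i i′ (no high) (no high′) _ = cong proj₁ (rank-injective (begin-equality
      rank (i , j₀)   ≡⟨ ≤-antisym (column≤s i) (≮⇒≥ high) ⟩
      s               ≡⟨ ≤-antisym (≮⇒≥ high′) (column≤s i′) ⟩
      rank (i′ , j₀)  ∎))
      where open ≤-Reasoning

KThin-rows≤ : ∀ {n m k} (w : KThin (GR n m) k) (s : ℕ) (j₀ : Fin m) →
              (∀ i → proj₁ w (i , j₀) ≤ s) → (∀ i → ∃ λ j → s ≤ proj₁ w (i , j)) →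
              n ≤ suc (k * 2)
KThin-rows≤ (rank , injective , cls , consistent) = rows≤ rank injective cls consistent

module _ {n m k} (0<n : 0 < n) (0<m : 0 < m)
         (w : KThin (GR n m) k) (bounded : ∀ v → proj₁ w v < n * m) where

  private
    rank : Fin n × Fin m → ℕ
    rank = proj₁ w

  FullLine : ℕ → Set
  FullLine t = (∃ λ i → ∀ j → rank (i , j) < t) ⊎ (∃ λ j → ∀ i → rank (i , j) < t)

  FullLine? : Decidable FullLine
  FullLine? t = any? (λ i → all? λ j → rank (i , j) <? t) ⊎-dec
                any? (λ j → all? λ i → rank (i , j) <? t)

  lines≤ : ∀ s → FullLine (suc s) → ¬ FullLine s → n ≤ suc (k * 2) ⊎ m ≤ suc (k * 2)
  lines≤ s (inj₂ (j₀ , column)) ¬full = inj₁ (KThin-rows≤ w s j₀ (s≤s⁻¹ ∘ column) λ i →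
    Product.map₂ ≮⇒≥ (¬∀⟶∃¬ m _ (λ j → rank (i , j) <? s) λ row → ¬full (inj₁ (i , row))))
  lines≤ s (inj₁ (i₀ , row)) ¬full = inj₂ (KThin-rows≤ (GR-transpose w) s i₀ (s≤s⁻¹ ∘ row) λ j →
    Product.map₂ ≮⇒≥ (¬∀⟶∃¬ n _ (λ i → rank (i , j) <? s) λ column → ¬full (inj₂ (j , column))))

  grid-lower : n ≤ suc (k * 2) ⊎ m ≤ suc (k * 2)
  grid-lower with least-witness FullLine? (inj₁ (fromℕ< 0<n , λ j → bounded _))
  ... | zero , inj₁ (_ , row) , _ = contradiction (row (fromℕ< 0<m)) λ ()
  ... | zero , inj₂ (_ , column) , _ = contradiction (column (fromℕ< 0<n)) λ ()
  ... | suc s , full , least = lines≤ s full λ full-s → 1+n≰n (least s full-s)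

⌊n/2⌋≡n/2 : ∀ n → ⌊ n /2⌋ ≡ n / 2
⌊n/2⌋≡n/2 0 = refl
⌊n/2⌋≡n/2 1 = refl
⌊n/2⌋≡n/2 (suc (suc n)) =
  trans (cong suc (⌊n/2⌋≡n/2 n)) (sym (m/n≡1+[m∸n]/n {2 + n} (s≤s (s≤s z≤n))))

1+⌊n/2⌋≡⌈n+1/2⌉ : ∀ n → suc ⌊ n /2⌋ ≡ ⌈ n + 1 /suc 1 ⌉
1+⌊n/2⌋≡⌈n+1/2⌉ n =
  trans (⌊n/2⌋≡n/2 (2 + n)) (cong (_/ 2) (trans (+-comm 2 n) (sym (+-assoc n 1 1))))

⌈n∸1/3⌉≤ : ∀ {n k} → n ≤ suc (k * 2) → ⌈ n ∸ 1 /suc 2 ⌉ ≤ k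
⌈n∸1/3⌉≤ {n} {k} n≤ = s≤s⁻¹ (m<n*o⇒m/o<n (begin-strict
  n ∸ 1 + 2  ≤⟨ +-monoˡ-≤ 2 (∸-monoˡ-≤ 1 n≤) ⟩
  k * 2 + 2  ≤⟨ +-monoˡ-≤ 2 (*-monoʳ-≤ k (n≤1+n 2)) ⟩
  k * 3 + 2  <⟨ +-monoʳ-< (k * 3) (n<1+n 2) ⟩
  k * 3 + 3  ≡⟨ +-comm (k * 3) 3 ⟩
  suc k * 3  ∎))
  where open ≤-Reasoning

theorem30 : (n m : ℕ) → 1 ≤ n → n ≤ m →
    Σ ℕ λ t → IsThinness (GR n m) t
      × ⌈ n ∸ 1 /suc 2 ⌉ ≤ t × t ≤ ⌈ n + 1 /suc 1 ⌉
theorem30 n m 1≤n n≤m =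
  let t , t-thin , t-least = least-witness KThin? upper
      w , w-bounded = bounded-witness t-thin
      n≤2t+1 = [ id , ≤-trans n≤m ]′ (grid-lower 1≤n (≤-trans 1≤n n≤m) w w-bounded)
  in t , (t-thin , t-least) , ⌈n∸1/3⌉≤ n≤2t+1 , t-least _ upper
  where
  open GridGraph n m
  upper : KThin (GR n m) ⌈ n + 1 /suc 1 ⌉
  upper = subst (KThin (GR n m)) (1+⌊n/2⌋≡⌈n+1/2⌉ n) (grid-thin n m)
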